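{- Let $p>2$ be a prime and $m$ a positive integer dividing $p-1$. Then $$(\mathbb{Z}/m\mathbb{Z})^\ast=\{\pm(t^2+s^2)\bmod m \;:\; t,s\in\mathbb{Z},\ \gcd(t^2+p^2s^2,\,6mp)=1\}.$$ -}

module Defs where

open import Data.Nat using (ℕ)
open import Data.Integer using (ℤ; +_; _*_; _-_; _+_; -_)
open import Data.Integer.Divisibility using (_∣_)
open import Data.Integer.GCD using (gcd)
open import Data.Product using (∃; ∃-syntax; _×_)
open import Data.Sum using (_⊎_)
open import Relation.Binary.PropositionalEquality using (_≡_)

IsUnitMod : ℕ → ℤ → Set
IsUnitMod m a = ∃[ b ] ((+ m) ∣ (a * b - + 1))

InSet : ℕ → ℕ → ℤ → Set
InSet p m a =
  ∃[ t ] ∃[ s ]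
    ( gcd (t * t + (+ p) * (+ p) * (s * s)) (+ 6 * + m * + p) ≡ + 1
    × ( (+ m) ∣ (a - (t * t + s * s))
      ⊎ (+ m) ∣ (a - (- (t * t + s * s))) ) )

module Submission where

-- Backward direction: p ≡ 1 (mod m), so t² + s² ≡ t² + p²s² (mod m); the latter
-- is prime to m, hence a unit, and so is a ≡ ±(t² + s²).
--
-- Forward direction, in two stages.
-- (1) For every unit a modulo m, a or −a is a sum of two squares modulo m
--     (units-are-±twoSquares), by strong induction on m.  An odd prime factor q
--     of m = q·k is split off by Hensel lifting if q ∣ k, and otherwise by the
--     Chinese remainder theorem together with the pigeonhole fact that every
--     class modulo q is a sum of two squares; a factor 16 ∣ m = 16r is split off
--     by lifting from 8r to 16r; what remains divides 8, where a or −a ≡ 1 or 5.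
-- (2) A representation a ≡ t² + s² (mod m) is moved within its classes mod m so
--     that p ∤ t, t + s is odd and 3 does not divide both t and s; then
--     t² + p²s² is prime to 2, 3, p and m, i.e. to 6mp (module Adjustment).

open import Defs
open import Data.Nat as ℕ using (ℕ; zero; suc; NonZero; _<_; _≤_; _∸_; _^_; s≤s; z≤n)
open import Data.Nat.Divisibility
  using (_∣_; _∣?_; divides; ∣-trans; ∣⇒≤; >⇒∤; m∣m*n; n∣m*n*o; *-monoˡ-∣; 1∣_; ∣1⇒≡1)
open import Data.Nat.DivMod using (m%n<n; m≡m%n+[m/n]*n)
open import Data.Nat.Coprimality as Coprimality
  using (Coprime; coprime-Bézout; coprime-divisor; coprime⇒gcd≡1; gcd≡1⇒coprime)
open import Data.Nat.GCD using (module Bézout)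
open import Data.Nat.Induction using (<-rec)
open import Data.Nat.Primality
  using (Prime; prime?; prime[2]; euclidsLemma; prime⇒irreducible; prime⇒nonTrivial)
open import Data.Nat.Primality.Factorisation using (factorise)
import Data.Nat.Properties as ℕ
open import Data.Integer using (ℤ; +_; _+_; _*_; _-_; -_; ∣_∣; 0ℤ; 1ℤ; _%ℕ_; _/ℕ_)
open import Data.Integer.Properties
  using ( pos-+; pos-*; ⊖-≥; [+m]-[+n]≡m⊖n; m-n≡m⊖n; abs-*; i≡j⇒i-j≡0; +∣i∣≡i⊎+∣i∣≡-i
        ; neg-involutive; +-identityˡ; *-identityˡ; *-identityʳ; +-comm; +-assoc; *-comm; +-injective)
open import Data.Integer.DivMod using (n%ℕd<d; a≡a%ℕn+[a/ℕn]*n)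
open import Data.Integer.Divisibility using () renaming (_∣_ to _∣ᵤ_)
open import Data.Integer.Divisibility.Signed as ∣ᵢ
  using (∣ᵤ⇒∣; ∣⇒∣ᵤ; ∣m∣n⇒∣m+n; ∣m∣n⇒∣m-n; ∣m⇒∣-m; ∣n⇒∣m*n; ∣m⇒∣m*n; ∣m+n∣m⇒∣n; ∣m+n∣n⇒∣m)
  renaming (_∣_ to _∣ᵢ_; _∣?_ to _∣ᵢ?_)
open import Data.Integer.GCD using (gcd)
open import Data.Integer.Tactic.RingSolver using (solve-∀)
open import Data.Fin as Fin using (Fin; toℕ; fromℕ<; splitAt; join)
import Data.Fin.Properties as Fin
open import Data.Fin.Properties using (pigeonhole; toℕ-fromℕ<; toℕ-injective; toℕ<n; join-splitAt)
open import Data.List using ([]; _∷_)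
open import Data.List.Relation.Unary.All using (_∷_)
open import Data.Product using (∃-syntax; _×_; _,_)
open import Data.Sum as Sum using (_⊎_; inj₁; inj₂; [_,_]′)
open import Function using (_∘_)
open import Function.Bundles using (_⇔_; mk⇔)
open import Relation.Binary.Definitions using (tri<; tri≈; tri>)
open import Relation.Nullary using (¬_; Dec; yes; no; contradiction)
open import Relation.Nullary.Decidable using (_×-dec_; ¬?; from-no; from-yes)
open import Relation.Binary.PropositionalEquality
  using (_≡_; _≢_; refl; sym; trans; cong; cong₂; subst; module ≡-Reasoning)

∣ᵢ-≡ : ∀ {d x y} → x ≡ y → d ∣ᵢ y → d ∣ᵢ x
∣ᵢ-≡ refl d∣y = d∣y

-- Congruence of integers modulo a natural number n: n divides the difference.
-- (A record rather than a synonym, so that x, y and n can be inferred.)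
infix 4 _≡_mod_
record _≡_mod_ (x y : ℤ) (n : ℕ) : Set where
  constructor mkMod
  field n∣x-y : + n ∣ᵢ x - y
open _≡_mod_ public

module _ {n : ℕ} where

  ≡⇒≡-mod : ∀ {x y} → x ≡ y → x ≡ y mod n
  ≡⇒≡-mod x≡y = mkMod (∣ᵢ-≡ (i≡j⇒i-j≡0 x≡y) (∣ᵢ.divides 0ℤ refl))

  mod-refl : ∀ {x} → x ≡ x mod n
  mod-refl = ≡⇒≡-mod refl

  mod-sym : ∀ {x y} → x ≡ y mod n → y ≡ x mod n
  mod-sym {x} {y} (mkMod d) = mkMod (∣ᵢ-≡ (flip x y) (∣m⇒∣-m d))
    where
    flip : ∀ x y → y - x ≡ - (x - y)
    flip = solve-∀

  mod-trans : ∀ {x y z} → x ≡ y mod n → y ≡ z mod n → x ≡ z mod n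
  mod-trans {x} {y} {z} (mkMod d) (mkMod e) = mkMod (∣ᵢ-≡ (telescope x y z) (∣m∣n⇒∣m+n d e))
    where
    telescope : ∀ x y z → x - z ≡ (x - y) + (y - z)
    telescope = solve-∀

  +-cong-mod : ∀ {x y u v} → x ≡ y mod n → u ≡ v mod n → x + u ≡ y + v mod n
  +-cong-mod {x} {y} {u} {v} (mkMod d) (mkMod e) = mkMod (∣ᵢ-≡ (split x y u v) (∣m∣n⇒∣m+n d e))
    where
    split : ∀ x y u v → (x + u) - (y + v) ≡ (x - y) + (u - v)
    split = solve-∀

  *-cong-mod : ∀ {x y u v} → x ≡ y mod n → u ≡ v mod n → x * u ≡ y * v mod n
  *-cong-mod {x} {y} {u} {v} (mkMod d) (mkMod e) =
    mkMod (∣ᵢ-≡ (split x y u v) (∣m∣n⇒∣m+n (∣m⇒∣m*n u d) (∣n⇒∣m*n y e)))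
    where
    split : ∀ x y u v → x * u - y * v ≡ (x - y) * u + y * (u - v)
    split = solve-∀

  -cong-mod : ∀ {x y} → x ≡ y mod n → - x ≡ - y mod n
  -cong-mod {x} {y} (mkMod d) = mkMod (∣ᵢ-≡ (negate x y) (∣m⇒∣-m d))
    where
    negate : ∀ x y → - x - - y ≡ - (x - y)
    negate = solve-∀

  +-multiple-mod : ∀ x k → x + k * + n ≡ x mod n
  +-multiple-mod x k = mkMod (∣ᵢ-≡ (cancel x k (+ n)) (∣ᵢ.divides k refl))
    where
    cancel : ∀ x k n → x + k * n - x ≡ k * n
    cancel = solve-∀

  ∣-resp-mod : ∀ {x y} → x ≡ y mod n → + n ∣ᵢ y → + n ∣ᵢ x
  ∣-resp-mod {x} {y} (mkMod d) n∣y = ∣ᵢ-≡ (split x y) (∣m∣n⇒∣m+n d n∣y)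
    where
    split : ∀ x y → x ≡ (x - y) + y
    split = solve-∀

mod-divisor : ∀ {d n x y} → d ∣ n → x ≡ y mod n → x ≡ y mod d
mod-divisor d∣n (mkMod e) = mkMod (∣ᵢ.∣-trans (∣ᵤ⇒∣ d∣n) e)

coprime-∣-* : ∀ {q n x} → Coprime q n → + q ∣ᵢ x → + n ∣ᵢ x → + (q ℕ.* n) ∣ᵢ x
coprime-∣-* {q} {n} q⊥n q∣x n∣x with ∣⇒∣ᵤ n∣x
... | divides k x≡kn with coprime-divisor q⊥n (subst (q ∣_) (trans x≡kn (ℕ.*-comm k n)) (∣⇒∣ᵤ q∣x))
... | divides j k≡jq =
  ∣ᵤ⇒∣ (divides j (trans x≡kn (trans (cong (ℕ._* n) k≡jq) (ℕ.*-assoc j q n))))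

coprime-mod-* : ∀ {q n x y} → Coprime q n → x ≡ y mod q → x ≡ y mod n → x ≡ y mod q ℕ.* n
coprime-mod-* q⊥n (mkMod d) (mkMod e) = mkMod (coprime-∣-* q⊥n d e)

cast-identity : ∀ a b c d → 1 ℕ.+ a ℕ.* b ≡ c ℕ.* d → 1ℤ + + a * + b ≡ + c * + d
cast-identity a b c d eq rewrite sym (pos-* a b) | sym (pos-* c d) = cong +_ eq

bézout : ∀ {q n} → Coprime q n → ∃[ u ] ∃[ v ] (u * + q + v * + n ≡ 1ℤ)
bézout {q} {n} q⊥n with coprime-Bézout q⊥n
... | Bézout.+- x y 1+yn≡xq = + x , - + y , combine (+ x) (+ q) (+ y) (+ n) (cast-identity y n x q 1+yn≡xq)
  where
  combine : ∀ x q y n → 1ℤ + y * n ≡ x * q → x * q + - y * n ≡ 1ℤ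
  combine x q y n eq = begin
    x * q + - y * n       ≡⟨ cong (λ z → z + - y * n) (sym eq) ⟩
    1ℤ + y * n + - y * n  ≡⟨ cancel y n ⟩
    1ℤ                    ∎
    where
    open ≡-Reasoning
    cancel : ∀ y n → 1ℤ + y * n + - y * n ≡ 1ℤ
    cancel = solve-∀
... | Bézout.-+ x y 1+xq≡yn = - + x , + y , combine (+ x) (+ q) (+ y) (+ n) (cast-identity x q y n 1+xq≡yn)
  where
  combine : ∀ x q y n → 1ℤ + x * q ≡ y * n → - x * q + y * n ≡ 1ℤ
  combine x q y n eq = begin
    - x * q + y * n       ≡⟨ cong (λ z → - x * q + z) (sym eq) ⟩
    - x * q + (1ℤ + x * q) ≡⟨ cancel x q ⟩
    1ℤ                    ∎
    where
    open ≡-Reasoning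
    cancel : ∀ x q → - x * q + (1ℤ + x * q) ≡ 1ℤ
    cancel = solve-∀

crt : ∀ {q n} → Coprime q n → ∀ x₁ x₂ → ∃[ x ] ((x ≡ x₁ mod q) × (x ≡ x₂ mod n))
crt {q} {n} q⊥n x₁ x₂ with bézout q⊥n
... | u , v , uq+vn≡1 =
  x₁ * (v * + n) + x₂ * (u * + q) ,
  mkMod (∣ᵢ.divides (u * (x₂ - x₁)) (component x₁ x₂ u v (+ q) (+ n) uq+vn≡1)) ,
  mkMod (∣ᵢ-≡ (cong (_- x₂) (swap (x₁ * (v * + n)) (x₂ * (u * + q))))
       (∣ᵢ.divides (v * (x₁ - x₂)) (component x₂ x₁ v u (+ n) (+ q) (trans (swap (v * + n) (u * + q)) uq+vn≡1))))
  where
  swap : ∀ a b → a + b ≡ b + a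
  swap = solve-∀
  -- Since v·n ≡ 1 (mod q), the combination x₁·v·n + x₂·u·q differs from x₁ by a multiple of q.
  component : ∀ x₁ x₂ u v Q N → u * Q + v * N ≡ 1ℤ →
              x₁ * (v * N) + x₂ * (u * Q) - x₁ ≡ (u * (x₂ - x₁)) * Q
  component x₁ x₂ u v Q N eq = begin
    x₁ * (v * N) + x₂ * (u * Q) - x₁               ≡⟨ expand x₁ x₂ u v Q N ⟩
    (u * (x₂ - x₁)) * Q + x₁ * (u * Q + v * N - 1ℤ) ≡⟨ cong (λ z → (u * (x₂ - x₁)) * Q + x₁ * (z - 1ℤ)) eq ⟩
    (u * (x₂ - x₁)) * Q + x₁ * (1ℤ - 1ℤ)           ≡⟨ drop (u * (x₂ - x₁) * Q) x₁ ⟩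
    (u * (x₂ - x₁)) * Q                           ∎
    where
    open ≡-Reasoning
    expand : ∀ x₁ x₂ u v Q N → x₁ * (v * N) + x₂ * (u * Q) - x₁ ≡ (u * (x₂ - x₁)) * Q + x₁ * (u * Q + v * N - 1ℤ)
    expand = solve-∀
    drop : ∀ a x → a + x * (1ℤ - 1ℤ) ≡ a
    drop = solve-∀

Unit : ℕ → ℤ → Set
Unit n a = ∃[ b ] (a * b ≡ 1ℤ mod n)

bézout⇒inverse : ∀ {n} u v y → u * + n + v * y ≡ 1ℤ → y * v ≡ 1ℤ mod n
bézout⇒inverse {n} u v y eq = mkMod (∣ᵢ.divides (- u) (begin
  y * v - 1ℤ                 ≡⟨ cong (λ z → y * v - z) (sym eq) ⟩
  y * v - (u * + n + v * y)  ≡⟨ rearrange y v u (+ n) ⟩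
  - u * + n                  ∎))
  where
  open ≡-Reasoning
  rearrange : ∀ y v u n → y * v - (u * n + v * y) ≡ - u * n
  rearrange = solve-∀

unit-neg : ∀ {n a} → Unit n a → Unit n (- a)
unit-neg {n} {a} (b , ab≡1) = - b , mod-trans (≡⇒≡-mod (neg-neg a b)) ab≡1
  where
  neg-neg : ∀ a b → - a * - b ≡ a * b
  neg-neg = solve-∀

coprime⇒unit : ∀ {n x} → Coprime n ∣ x ∣ → Unit n x
coprime⇒unit {n} {x} n⊥x with bézout n⊥x | +∣i∣≡i⊎+∣i∣≡-i x
... | u , v , eq | inj₁ ∣x∣≡x = subst (Unit n) ∣x∣≡x (v , bézout⇒inverse u v _ eq)
... | u , v , eq | inj₂ ∣x∣≡-x =
  subst (Unit n) (trans (cong -_ ∣x∣≡-x) (neg-involutive x)) (unit-neg {a = + ∣ x ∣} (v , bézout⇒inverse u v _ eq))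

unit-divisor : ∀ {d n a} → d ∣ n → Unit n a → Unit d a
unit-divisor d∣n (b , ab≡1) = b , mod-divisor d∣n ab≡1

unit-cong : ∀ {n a a′} → a ≡ a′ mod n → Unit n a → Unit n a′
unit-cong {a = a} {a′} a≡a′ (b , ab≡1) = b , mod-trans (*-cong-mod (mod-sym a≡a′) mod-refl) ab≡1

unit⇒no-common-factor : ∀ {n d a} → Unit n a → d ∣ n → + d ∣ᵢ a → d ≡ 1
unit⇒no-common-factor {a = a} (b , ab≡1) d∣n d∣a =
  ∣1⇒≡1 (∣⇒∣ᵤ (∣ᵢ-≡ (one a b) (∣m∣n⇒∣m-n (∣m⇒∣m*n b d∣a) (n∣x-y (mod-divisor d∣n ab≡1)))))
  where
  one : ∀ a b → 1ℤ ≡ a * b - (a * b - 1ℤ)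
  one = solve-∀

prime∤⇒coprime : ∀ {q x} → Prime q → ¬ q ∣ x → Coprime q x
prime∤⇒coprime q-prime q∤x (d∣q , d∣x) with prime⇒irreducible q-prime d∣q
... | inj₁ d≡1 = d≡1
... | inj₂ refl = contradiction d∣x q∤x

prime[3] : Prime 3
prime[3] = from-yes (prime? 3)

prime∤⇒coprimeᵢ : ∀ {r X} → Prime r → ¬ (+ r ∣ᵢ X) → Coprime ∣ X ∣ r
prime∤⇒coprimeᵢ r-prime r∤X = Coprimality.sym (prime∤⇒coprime r-prime (λ r∣X → r∤X (∣ᵤ⇒∣ r∣X)))

unit⇒coprime : ∀ {m x} → Unit m x → Coprime m ∣ x ∣
unit⇒coprime {x = x} unit (d∣m , d∣x) = unit⇒no-common-factor {a = x} unit d∣m (∣ᵤ⇒∣ d∣x)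

unit⇒prime∤ : ∀ {m q a} → Unit m a → Prime q → q ∣ m → ¬ (+ q ∣ᵢ a)
unit⇒prime∤ unit q-prime q∣m q∣a =
  ℕ.nonTrivial⇒≢1 {{prime⇒nonTrivial q-prime}} (unit⇒no-common-factor unit q∣m q∣a)

∤-neg : ∀ {d a} → ¬ (d ∣ᵢ a) → ¬ (d ∣ᵢ - a)
∤-neg {d} {a} d∤a d∣-a = d∤a (subst (d ∣ᵢ_) (neg-involutive a) (∣m⇒∣-m d∣-a))

≡-remainder : ∀ x n .{{_ : NonZero n}} → x ≡ + (x %ℕ n) mod n
≡-remainder x n = mkMod (∣ᵢ.divides (x /ℕ n) (begin
  x - + (x %ℕ n)                              ≡⟨ cong (_- + (x %ℕ n)) (a≡a%ℕn+[a/ℕn]*n x n) ⟩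
  + (x %ℕ n) + (x /ℕ n) * + n - + (x %ℕ n)    ≡⟨ cancel (+ (x %ℕ n)) (x /ℕ n) (+ n) ⟩
  (x /ℕ n) * + n                              ∎))
  where
  open ≡-Reasoning
  cancel : ∀ r k n → r + k * n - r ≡ k * n
  cancel = solve-∀

odd⇒≡1 : ∀ {x} → ¬ (+ 2 ∣ᵢ x) → x ≡ 1ℤ mod 2
odd⇒≡1 {x} x-odd = by-remainder (x %ℕ 2) (n%ℕd<d x 2) (≡-remainder x 2)
  where
  by-remainder : ∀ r → r < 2 → x ≡ + r mod 2 → x ≡ 1ℤ mod 2
  by-remainder 0 _ x≡0 = contradiction (∣-resp-mod x≡0 (∣ᵢ.divides 0ℤ refl)) x-odd
  by-remainder 1 _ x≡1 = x≡1
  by-remainder (suc (suc _)) (s≤s (s≤s ())) _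

square≡self-mod2 : ∀ x → x * x ≡ x mod 2
square≡self-mod2 x = by-remainder (x %ℕ 2) (n%ℕd<d x 2) (≡-remainder x 2)
  where
  by-remainder : ∀ r → r < 2 → x ≡ + r mod 2 → x * x ≡ x mod 2
  by-remainder 0 _ x≡0 = mod-trans (*-cong-mod x≡0 x≡0) (mod-sym x≡0)
  by-remainder 1 _ x≡1 = mod-trans (*-cong-mod x≡1 x≡1) (mod-sym x≡1)
  by-remainder (suc (suc _)) (s≤s (s≤s ())) _

prime∣prime⇒≡ : ∀ {q r} → Prime q → Prime r → q ∣ r → q ≡ r
prime∣prime⇒≡ q-prime r-prime q∣r with prime⇒irreducible r-prime q∣r
... | inj₁ q≡1 = contradiction q≡1 (ℕ.nonTrivial⇒≢1 {{prime⇒nonTrivial q-prime}})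
... | inj₂ q≡r = q≡r

odd-prime-form : ∀ {q} → Prime q → q ≢ 2 → ∃[ h ] (q ≡ suc (h ℕ.+ h))
odd-prime-form {q} q-prime q≢2 = by-remainder (q ℕ.% 2) (m%n<n q 2) (m≡m%n+[m/n]*n q 2)
  where
  by-remainder : ∀ r → r < 2 → q ≡ r ℕ.+ (q ℕ./ 2) ℕ.* 2 → ∃[ h ] (q ≡ suc (h ℕ.+ h))
  by-remainder 0 _ q≡2k = contradiction (sym (prime∣prime⇒≡ prime[2] q-prime (divides (q ℕ./ 2) q≡2k))) q≢2
  by-remainder 1 _ q≡2k+1 = q ℕ./ 2 , trans q≡2k+1 (cong suc (double (q ℕ./ 2)))
    where
    double : ∀ k → k ℕ.* 2 ≡ k ℕ.+ k
    double k = trans (ℕ.*-comm k 2) (cong (k ℕ.+_) (ℕ.+-identityʳ k))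
  by-remainder (suc (suc _)) (s≤s (s≤s ())) _

TwoSquares : ℕ → ℤ → Set
TwoSquares n A = ∃[ t ] ∃[ s ] (A ≡ t * t + s * s mod n)

sum-of-squares-cong : ∀ {n t t′ s s′} → t ≡ t′ mod n → s ≡ s′ mod n →
                      t * t + s * s ≡ t′ * t′ + s′ * s′ mod n
sum-of-squares-cong t≡t′ s≡s′ = +-cong-mod (*-cong-mod t≡t′ t≡t′) (*-cong-mod s≡s′ s≡s′)

twoSquares-divisor : ∀ {d n A} → d ∣ n → TwoSquares n A → TwoSquares d A
twoSquares-divisor d∣n (t , s , A≡) = t , s , mod-divisor d∣n A≡

twoSquares-crt : ∀ {q n A} → Coprime q n → TwoSquares q A → TwoSquares n A → TwoSquares (q ℕ.* n) A
twoSquares-crt q⊥n (t₁ , s₁ , A≡₁) (t₂ , s₂ , A≡₂) =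
  let t , t≡t₁ , t≡t₂ = crt q⊥n t₁ t₂
      s , s≡s₁ , s≡s₂ = crt q⊥n s₁ s₂
  in t , s , coprime-mod-* q⊥n (mod-trans A≡₁ (mod-sym (sum-of-squares-cong t≡t₁ s≡s₁)))
                               (mod-trans A≡₂ (mod-sym (sum-of-squares-cong t≡t₂ s≡s₂)))

first-coordinate-prime-to : ∀ {q n A t s} → q ∣ n → ¬ (+ q ∣ᵢ A) → A ≡ t * t + s * s mod n →
                            ∃[ t′ ] ∃[ s′ ] (¬ (+ q ∣ᵢ t′) × (A ≡ t′ * t′ + s′ * s′ mod n))
first-coordinate-prime-to {q} {n} {A} {t} {s} q∣n q∤A A≡ with + q ∣ᵢ? t | + q ∣ᵢ? s
... | no q∤t  | _       = t , s , q∤t , A≡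
... | yes _   | no q∤s  = s , t , q∤s , mod-trans A≡ (≡⇒≡-mod (+-comm (t * t) (s * s)))
... | yes q∣t | yes q∣s =
  contradiction (∣-resp-mod (mod-divisor q∣n A≡) (∣m∣n⇒∣m+n (∣m⇒∣m*n t q∣t) (∣m⇒∣m*n s q∣s))) q∤A

∣-*-factor : ∀ {q} n {z} → + q ∣ᵢ z → + (q ℕ.* n) ∣ᵢ + n * z
∣-*-factor {q} n (∣ᵢ.divides j refl) = ∣ᵢ.divides j (begin
  + n * (j * + q)     ≡⟨ rearrange (+ n) j (+ q) ⟩
  j * (+ q * + n)     ≡⟨ cong (j *_) (sym (pos-* q n)) ⟩
  j * + (q ℕ.* n)     ∎)
  where
  open ≡-Reasoning
  rearrange : ∀ n j q → n * (j * q) ≡ j * (q * n)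
  rearrange = solve-∀

-- Hensel lifting at an odd prime q dividing n.  If A − (t² + s²) = c·n and
-- w inverts 2t modulo q, then t′ = t + n·c·w satisfies
-- A − (t′² + s²) = n·(−c·(2tw − 1) − n·(cw)²), a multiple of q·n.
hensel-odd : ∀ {q n A t s} → Prime q → q ≢ 2 → q ∣ n → ¬ (+ q ∣ᵢ t) →
             A ≡ t * t + s * s mod n → TwoSquares (q ℕ.* n) A
hensel-odd {q} {n} {A} {t} {s} q-prime q≢2 q∣n q∤t (mkMod (∣ᵢ.divides c A-T≡cn)) =
  lift (coprime⇒unit {q} {+ 2 * t} (prime∤⇒coprime q-prime q∤2t))
  where
  q∤2t : ¬ q ∣ ∣ + 2 * t ∣
  q∤2t q∣2t with euclidsLemma 2 ∣ t ∣ q-prime (subst (q ∣_) (abs-* (+ 2) t) q∣2t)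
  ... | inj₁ q∣2 = q≢2 (prime∣prime⇒≡ q-prime prime[2] q∣2)
  ... | inj₂ q∣t = q∤t (∣ᵤ⇒∣ q∣t)
  expand : ∀ A t s c w n → A - ((t + n * (c * w)) * (t + n * (c * w)) + s * s)
           ≡ (A - (t * t + s * s) - c * n) + n * (- c * (+ 2 * t * w - 1ℤ) - n * ((c * w) * (c * w)))
  expand = solve-∀
  lift : Unit q (+ 2 * t) → TwoSquares (q ℕ.* n) A
  lift (w , 2tw≡1) = t + + n * (c * w) , s , mkMod (∣ᵢ-≡ lifted (∣-*-factor n q∣error))
    where
    error : ℤ
    error = - c * (+ 2 * t * w - 1ℤ) - + n * ((c * w) * (c * w))
    q∣error : + q ∣ᵢ error
    q∣error = ∣m∣n⇒∣m-n (∣n⇒∣m*n (- c) (n∣x-y 2tw≡1)) (∣m⇒∣m*n {m = + n} ((c * w) * (c * w)) (∣ᵤ⇒∣ q∣n))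
    open ≡-Reasoning
    lifted : A - ((t + + n * (c * w)) * (t + + n * (c * w)) + s * s) ≡ + n * error
    lifted = begin
      A - ((t + + n * (c * w)) * (t + + n * (c * w)) + s * s) ≡⟨ expand A t s c w (+ n) ⟩
      (A - (t * t + s * s) - c * + n) + + n * error          ≡⟨ cong (_+ + n * error) (i≡j⇒i-j≡0 A-T≡cn) ⟩
      0ℤ + + n * error                                       ≡⟨ +-identityˡ (+ n * error) ⟩
      + n * error                                            ∎

-- Hensel lifting at 2, from modulus 8r to 16r.  If t is odd and
-- A − (t² + s²) = c·8r, then t′ = t + 4r·c·t satisfies
-- A − (t′² + s²) = −8rc·(t² − 1) − 16r·r(ct)², and 2 ∣ t² − 1.
hensel-two : ∀ r {A t s} → ¬ (+ 2 ∣ᵢ t) → A ≡ t * t + s * s mod (8 ℕ.* r) → TwoSquares (16 ℕ.* r) A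
hensel-two r {A} {t} {s} t-odd (mkMod (∣ᵢ.divides c A-T≡c8r)) =
  lift (n∣x-y (*-cong-mod (odd⇒≡1 t-odd) (odd⇒≡1 t-odd)))
  where
  R : ℤ
  R = + r
  expand : ∀ A t s c R → A - ((t + + 4 * R * (c * t)) * (t + + 4 * R * (c * t)) + s * s)
           ≡ (A - (t * t + s * s) - c * (+ 8 * R)) - (+ 8 * R * c) * (t * t - 1ℤ) - + 16 * R * (R * (c * t) * (c * t))
  expand = solve-∀
  collect : ∀ R c e t → 0ℤ - (+ 8 * R * c) * (e * + 2) - + 16 * R * (R * (c * t) * (c * t))
            ≡ (- (c * e) - R * (c * t) * (c * t)) * (+ 16 * R)
  collect = solve-∀
  lift : + 2 ∣ᵢ t * t - 1ℤ → TwoSquares (16 ℕ.* r) A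
  lift (∣ᵢ.divides e t²-1≡2e) =
    t + + 4 * R * (c * t) , s ,
    mkMod (∣ᵢ.divides (- (c * e) - R * (c * t) * (c * t)) (trans lifted (cong ((- (c * e) - R * (c * t) * (c * t)) *_) (sym (pos-* 16 r)))))
    where
    open ≡-Reasoning
    lifted : A - ((t + + 4 * R * (c * t)) * (t + + 4 * R * (c * t)) + s * s) ≡ (- (c * e) - R * (c * t) * (c * t)) * (+ 16 * R)
    lifted = begin
      A - ((t + + 4 * R * (c * t)) * (t + + 4 * R * (c * t)) + s * s)
        ≡⟨ expand A t s c R ⟩
      (A - (t * t + s * s) - c * (+ 8 * R)) - (+ 8 * R * c) * (t * t - 1ℤ) - + 16 * R * (R * (c * t) * (c * t))
        ≡⟨ cong₂ (λ x y → x - (+ 8 * R * c) * y - + 16 * R * (R * (c * t) * (c * t)))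
                 (i≡j⇒i-j≡0 (trans A-T≡c8r (cong (c *_) (pos-* 8 r)))) t²-1≡2e ⟩
      0ℤ - (+ 8 * R * c) * (e * + 2) - + 16 * R * (R * (c * t) * (c * t))
        ≡⟨ collect R c e t ⟩
      (- (c * e) - R * (c * t) * (c * t)) * (+ 16 * R)
        ∎

module _ {h : ℕ} (q-prime : Prime (suc (h ℕ.+ h))) where

  private
    q : ℕ
    q = suc (h ℕ.+ h)

  -- The squares of 0, …, h are pairwise incongruent modulo q: for x < y ≤ h,
  -- q would divide y² − x² = (y − x)(y + x), but both factors lie in (0, q).
  squares-distinct< : ∀ {x y} → x < y → y ≤ h → ¬ (+ x * + x ≡ + y * + y mod q)
  squares-distinct< {x} {y} x<y y≤h x²≡y² with euclidsLemma (y ∸ x) (y ℕ.+ x) q-prime q∣product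
    where
    difference : + (y ∸ x) ≡ + y - + x
    difference = sym (trans ([+m]-[+n]≡m⊖n y x) (⊖-≥ (ℕ.<⇒≤ x<y)))
    factor : + ((y ∸ x) ℕ.* (y ℕ.+ x)) ≡ + y * + y - + x * + x
    factor = begin
      + ((y ∸ x) ℕ.* (y ℕ.+ x))   ≡⟨ pos-* (y ∸ x) (y ℕ.+ x) ⟩
      + (y ∸ x) * + (y ℕ.+ x)     ≡⟨ cong₂ _*_ difference (pos-+ y x) ⟩
      (+ y - + x) * (+ y + + x)   ≡⟨ squares (+ y) (+ x) ⟩
      + y * + y - + x * + x       ∎
      where
      open ≡-Reasoning
      squares : ∀ y x → (y - x) * (y + x) ≡ y * y - x * x
      squares = solve-∀
    q∣product : q ∣ (y ∸ x) ℕ.* (y ℕ.+ x)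
    q∣product = ∣⇒∣ᵤ (∣ᵢ-≡ factor (n∣x-y (mod-sym x²≡y²)))
  ... | inj₁ q∣y-x = >⇒∤ {{ℕ.>-nonZero (ℕ.m<n⇒0<n∸m x<y)}}
                         (s≤s (ℕ.≤-trans (ℕ.m∸n≤m y x) (ℕ.≤-trans y≤h (ℕ.m≤m+n h h)))) q∣y-x
  ... | inj₂ q∣y+x = >⇒∤ {{ℕ.>-nonZero (ℕ.≤-trans (s≤s z≤n) (ℕ.≤-trans x<y (ℕ.m≤m+n y x)))}}
                         (s≤s (ℕ.+-mono-≤ y≤h (ℕ.≤-trans (ℕ.<⇒≤ x<y) y≤h))) q∣y+x

  squares-distinct : ∀ {x y} → x ≤ h → y ≤ h → + x * + x ≡ + y * + y mod q → x ≡ y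
  squares-distinct {x} {y} x≤h y≤h x²≡y² with ℕ.<-cmp x y
  ... | tri< x<y _ _ = contradiction x²≡y² (squares-distinct< x<y y≤h)
  ... | tri≈ _ x≡y _ = x≡y
  ... | tri> _ _ y<x = contradiction (mod-sym x²≡y²) (squares-distinct< y<x x≤h)

  -- Pigeonhole: the q + 1 numbers x² and A − y² (0 ≤ x, y ≤ h) fall into q
  -- residue classes; two squares (or two numbers A − y²) never collide, so some
  -- x² ≡ A − y², i.e. A ≡ x² + y² (mod q).
  twoSquares-mod-prime : ∀ A → TwoSquares q A
  twoSquares-mod-prime A =
    let i , j , i<j , same = pigeonhole fewer-classes (residue ∘ value ∘ splitAt (suc h))
    in collision (splitAt (suc h) i) (splitAt (suc h) j)
                 (λ eq → Fin.<-irrefl (splitAt-injective eq) i<j) (same-residue same)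
    where
    value : Fin (suc h) ⊎ Fin (suc h) → ℤ
    value (inj₁ x) = + toℕ x * + toℕ x
    value (inj₂ y) = A - + toℕ y * + toℕ y

    residue : ℤ → Fin q
    residue z = fromℕ< (n%ℕd<d z q)

    same-residue : ∀ {z z′} → residue z ≡ residue z′ → z ≡ z′ mod q
    same-residue {z} {z′} eq =
      mod-trans (≡-remainder z q) (subst (λ r → + r ≡ z′ mod q) remainders-equal (mod-sym (≡-remainder z′ q)))
      where
      remainders-equal : z′ %ℕ q ≡ z %ℕ q
      remainders-equal =
        trans (sym (toℕ-fromℕ< (n%ℕd<d z′ q))) (trans (cong toℕ (sym eq)) (toℕ-fromℕ< (n%ℕd<d z q)))

    fewer-classes : q < suc h ℕ.+ suc h
    fewer-classes = s≤s (ℕ.≤-reflexive (sym (ℕ.+-suc h h)))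

    splitAt-injective : ∀ {i j} → splitAt (suc h) {suc h} i ≡ splitAt (suc h) j → i ≡ j
    splitAt-injective {i} {j} eq =
      trans (sym (join-splitAt (suc h) (suc h) i)) (trans (cong (join (suc h) (suc h)) eq) (join-splitAt (suc h) (suc h) j))

    bound : (x : Fin (suc h)) → toℕ x ≤ h
    bound x = ℕ.≤-pred (toℕ<n x)

    double-minus : ∀ A X → A - (A - X) ≡ X
    double-minus = solve-∀

    minus-plus : ∀ A X → A - X + X ≡ A
    minus-plus = solve-∀

    collision : ∀ u v → u ≢ v → value u ≡ value v mod q → TwoSquares q A
    collision (inj₁ x) (inj₁ y) x≢y x²≡y² =
      contradiction (cong inj₁ (toℕ-injective (squares-distinct (bound x) (bound y) x²≡y²))) x≢y
    collision (inj₂ x) (inj₂ y) x≢y A-x²≡A-y² =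
      contradiction (cong inj₂ (toℕ-injective (squares-distinct (bound x) (bound y) (cancel A-x²≡A-y²)))) x≢y
      where
      cancel : ∀ {X Y} → A - X ≡ A - Y mod q → X ≡ Y mod q
      cancel {X} {Y} e = mod-trans (≡⇒≡-mod (sym (double-minus A X)))
                           (mod-trans (+-cong-mod (mod-refl {x = A}) (-cong-mod e)) (≡⇒≡-mod (double-minus A Y)))
    collision (inj₁ x) (inj₂ y) _ x²≡A-y² = + toℕ x , + toℕ y ,
      mod-trans (≡⇒≡-mod (sym (minus-plus A (+ toℕ y * + toℕ y)))) (+-cong-mod (mod-sym x²≡A-y²) mod-refl)
    collision (inj₂ x) (inj₁ y) _ A-x²≡y² = + toℕ y , + toℕ x ,
      mod-trans (≡⇒≡-mod (sym (minus-plus A (+ toℕ x * + toℕ x)))) (+-cong-mod A-x²≡y² mod-refl)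

twoSquares-mod-odd-prime : ∀ {q} → Prime q → q ≢ 2 → ∀ A → TwoSquares q A
twoSquares-mod-odd-prime q-prime q≢2 A with odd-prime-form q-prime q≢2
... | h , refl = twoSquares-mod-prime {h} q-prime A

-- Modulo 8, an odd a has a or −a congruent to 1 = 1² + 0² or to 5 = 2² + 1².
twoSquares-mod8 : ∀ {a} → ¬ (+ 2 ∣ᵢ a) → TwoSquares 8 a ⊎ TwoSquares 8 (- a)
twoSquares-mod8 {a} a-odd = by-remainder (a %ℕ 8) (n%ℕd<d a 8) (≡-remainder a 8)
  where
  even : ∀ {r} → a ≡ + r mod 8 → + 2 ∣ᵢ + r → TwoSquares 8 a ⊎ TwoSquares 8 (- a)
  even a≡r 2∣r = contradiction (∣-resp-mod (mod-divisor (divides 4 refl) a≡r) 2∣r) a-odd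

  -- −3 ≡ 5 and −7 ≡ 1 modulo 8.
  negate : ∀ {r r′} → a ≡ + r mod 8 → - + r - r′ ≡ - 1ℤ * + 8 → - a ≡ r′ mod 8
  negate a≡r eq = mod-trans (-cong-mod a≡r) (mkMod (∣ᵢ.divides (- 1ℤ) eq))

  by-remainder : ∀ r → r < 8 → a ≡ + r mod 8 → TwoSquares 8 a ⊎ TwoSquares 8 (- a)
  by-remainder 0 _ a≡0 = even a≡0 (∣ᵢ.divides 0ℤ refl)
  by-remainder 1 _ a≡1 = inj₁ (1ℤ , 0ℤ , a≡1)
  by-remainder 2 _ a≡2 = even a≡2 (∣ᵢ.divides 1ℤ refl)
  by-remainder 3 _ a≡3 = inj₂ (+ 2 , 1ℤ , negate a≡3 refl)
  by-remainder 4 _ a≡4 = even a≡4 (∣ᵢ.divides (+ 2) refl)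
  by-remainder 5 _ a≡5 = inj₁ (+ 2 , 1ℤ , a≡5)
  by-remainder 6 _ a≡6 = even a≡6 (∣ᵢ.divides (+ 3) refl)
  by-remainder 7 _ a≡7 = inj₂ (1ℤ , 0ℤ , negate a≡7 refl)
  by-remainder (suc (suc (suc (suc (suc (suc (suc (suc _))))))))
               (s≤s (s≤s (s≤s (s≤s (s≤s (s≤s (s≤s (s≤s ())))))))) _

twoSquares-lift-odd : ∀ {q n A} → Prime q → q ≢ 2 → ¬ (+ q ∣ᵢ A) → TwoSquares n A → TwoSquares (q ℕ.* n) A
twoSquares-lift-odd {q} {n} {A} q-prime q≢2 q∤A (t , s , A≡) with q ∣? n
... | yes q∣n = lift (first-coordinate-prime-to {t = t} {s} q∣n q∤A A≡)
  where
  lift : ∃[ t′ ] ∃[ s′ ] (¬ (+ q ∣ᵢ t′) × (A ≡ t′ * t′ + s′ * s′ mod n)) → TwoSquares (q ℕ.* n) A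
  lift (t′ , s′ , q∤t′ , A≡′) = hensel-odd {t = t′} {s′} q-prime q≢2 q∣n q∤t′ A≡′
... | no q∤n  = twoSquares-crt (prime∤⇒coprime q-prime q∤n) (twoSquares-mod-odd-prime q-prime q≢2 A) (t , s , A≡)

twoSquares-lift-two : ∀ r {A} → ¬ (+ 2 ∣ᵢ A) → TwoSquares (8 ℕ.* r) A → TwoSquares (16 ℕ.* r) A
twoSquares-lift-two r {A} A-odd (t , s , A≡) =
  lift (first-coordinate-prime-to {t = t} {s} (∣-trans (divides 4 refl) (m∣m*n r)) A-odd A≡)
  where
  lift : ∃[ t′ ] ∃[ s′ ] (¬ (+ 2 ∣ᵢ t′) × (A ≡ t′ * t′ + s′ * s′ mod (8 ℕ.* r))) → TwoSquares (16 ℕ.* r) A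
  lift (t′ , s′ , t′-odd , A≡′) = hensel-two r {t = t′} {s′} t′-odd A≡′

twoSquares-mod1 : ∀ {m} A → m ∣ 1 → TwoSquares m A
twoSquares-mod1 A m∣1 = 0ℤ , 0ℤ , mod-divisor m∣1 (mkMod (∣ᵢ.divides (A - 0ℤ) (sym (*-identityʳ (A - 0ℤ)))))

prime-factor : ∀ {m} → 2 ≤ m → ∃[ q ] (Prime q × q ∣ m)
prime-factor {suc zero} (s≤s ())
prime-factor {suc (suc m)} _ with factorise (suc (suc m))
... | record { factors = [] ; isFactorisation = () }
... | record { factors = q ∷ qs ; isFactorisation = eq ; factorsPrime = q-prime ∷ _ } =
  q , q-prime , subst (q ∣_) (sym eq) (m∣m*n _)

power-of-two : ∀ j {m} → 1 ≤ m → (∀ {q} → Prime q → q ∣ m → q ≡ 2) → ¬ (2 ^ suc j ∣ m) → m ∣ 2 ^ j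
power-of-two j {m} 1≤m only-2 2^j+1∤m with 2 ∣? m
power-of-two j {suc zero} _ _ _ | no _ = 1∣ _
power-of-two j {suc (suc m)} _ only-2 _ | no 2∤m =
  let q , q-prime , q∣m = prime-factor (s≤s (s≤s z≤n)) in
  contradiction (subst (_∣ suc (suc m)) (only-2 q-prime q∣m) q∣m) 2∤m
power-of-two zero    _ _ 2^1∤m | yes 2∣m = contradiction 2∣m 2^1∤m
power-of-two (suc j) () _ _ | yes (divides zero refl)
power-of-two (suc j) {m} 1≤m only-2 2^j+2∤m | yes (divides (suc k) m≡2k) =
  subst (_∣ 2 ^ suc j) (sym m≡2k) (subst (suc k ℕ.* 2 ∣_) (ℕ.*-comm (2 ^ j) 2) (*-monoˡ-∣ 2 k∣2^j))
  where
  k∣2^j : suc k ∣ 2 ^ j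
  k∣2^j = power-of-two j (s≤s z≤n)
            (λ q-prime q∣k → only-2 q-prime (subst (_ ∣_) (sym m≡2k) (∣-trans q∣k (m∣m*n 2))))
            (λ 2^j+1∣k → 2^j+2∤m (subst (_∣ m) (ℕ.*-comm (2 ^ suc j) 2) (subst (_ ∣_) (sym m≡2k) (*-monoˡ-∣ 2 2^j+1∣k))))

±TwoSquares : ℕ → ℤ → Set
±TwoSquares m a = TwoSquares m a ⊎ TwoSquares m (- a)

UnitsAre±TwoSquares : ℕ → Set
UnitsAre±TwoSquares m = 1 ≤ m → ∀ {a} → Unit m a → ±TwoSquares m a

odd-prime-step : ∀ {m q} → Prime q → q ≢ 2 → q ∣ m →
                 (∀ {k} → k < m → UnitsAre±TwoSquares k) → UnitsAre±TwoSquares m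
odd-prime-step q-prime q≢2 (divides zero refl) ih ()
odd-prime-step {m} {q} q-prime q≢2 (divides (suc k) m≡kq) ih _ {a} unit =
  subst (λ n → ±TwoSquares n a) (sym m≡qk)
        (Sum.map (twoSquares-lift-odd q-prime q≢2 q∤a) (twoSquares-lift-odd q-prime q≢2 (∤-neg q∤a))
                 (ih k<m (s≤s z≤n) (unit-divisor {a = a} (divides q m≡qk) unit)))
  where
  m≡qk : m ≡ q ℕ.* suc k
  m≡qk = trans m≡kq (ℕ.*-comm (suc k) q)
  k<m : suc k < m
  k<m = subst (suc k <_) (sym m≡kq) (ℕ.m<m*n (suc k) q (ℕ.nonTrivial⇒n>1 q {{prime⇒nonTrivial q-prime}}))
  q∤a : ¬ (+ q ∣ᵢ a)
  q∤a = unit⇒prime∤ unit q-prime (divides (suc k) m≡kq)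

sixteen-step : ∀ {m} → 16 ∣ m → (∀ {k} → k < m → UnitsAre±TwoSquares k) → UnitsAre±TwoSquares m
sixteen-step (divides zero refl) ih ()
sixteen-step {m} (divides (suc r) m≡16r) ih _ {a} unit =
  subst (λ n → ±TwoSquares n a) (sym m≡16r′)
        (Sum.map (twoSquares-lift-two (suc r) a-odd) (twoSquares-lift-two (suc r) (∤-neg a-odd))
                 (ih 8r<m (s≤s z≤n) (unit-divisor {a = a} (divides 2 m≡2·8r) unit)))
  where
  m≡16r′ : m ≡ 16 ℕ.* suc r
  m≡16r′ = trans m≡16r (ℕ.*-comm (suc r) 16)
  m≡2·8r : m ≡ 2 ℕ.* (8 ℕ.* suc r)
  m≡2·8r = trans m≡16r′ (ℕ.*-assoc 2 8 (suc r))
  8r<m : 8 ℕ.* suc r < m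
  8r<m = subst (8 ℕ.* suc r <_) (sym (trans m≡2·8r (ℕ.*-comm 2 (8 ℕ.* suc r)))) (ℕ.m<m*n (8 ℕ.* suc r) 2 (s≤s (s≤s z≤n)))
  a-odd : ¬ (+ 2 ∣ᵢ a)
  a-odd = unit⇒prime∤ unit prime[2] (∣-trans (divides 8 refl) (divides (suc r) m≡16r))

-- Base case: the only prime factor of m is 2 and 16 ∤ m, so m ∣ 8; for odd m even m = 1.
power-of-two-case : ∀ {m} → 1 ≤ m → (∀ {q} → Prime q → q ∣ m → q ≡ 2) → ¬ (16 ∣ m) → UnitsAre±TwoSquares m
power-of-two-case {m} 1≤m only-2 16∤m _ {a} unit with 2 ∣? m
... | yes 2∣m = Sum.map (twoSquares-divisor m∣8) (twoSquares-divisor m∣8) (twoSquares-mod8 (unit⇒prime∤ unit prime[2] 2∣m))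
  where
  m∣8 : m ∣ 8
  m∣8 = power-of-two 3 1≤m only-2 16∤m
... | no 2∤m = inj₁ (twoSquares-mod1 a (power-of-two 0 1≤m only-2 2∤m))

OddPrimeFactor : ℕ → ℕ → Set
OddPrimeFactor m q = Prime q × q ≢ 2 × q ∣ m

odd-prime-factor? : ∀ m → Dec (∃[ q ] (q < suc m × OddPrimeFactor m q))
odd-prime-factor? m = ℕ.anyUpTo? (λ q → prime? q ×-dec ¬? (q ℕ.≟ 2) ×-dec q ∣? m) (suc m)

only-prime-factor-2 : ∀ {m} → 1 ≤ m → ¬ (∃[ q ] (q < suc m × OddPrimeFactor m q)) →
                      ∀ {q} → Prime q → q ∣ m → q ≡ 2
only-prime-factor-2 {m} 1≤m none {q} q-prime q∣m with q ℕ.≟ 2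
... | yes q≡2 = q≡2
... | no q≢2  = contradiction (q , s≤s (∣⇒≤ {{ℕ.>-nonZero 1≤m}} q∣m) , q-prime , q≢2 , q∣m) none

units-are-±twoSquares : ∀ m → UnitsAre±TwoSquares m
units-are-±twoSquares = <-rec UnitsAre±TwoSquares step
  where
  step : ∀ m → (∀ {k} → k < m → UnitsAre±TwoSquares k) → UnitsAre±TwoSquares m
  step m ih with odd-prime-factor? m | 16 ∣? m
  ... | yes (_ , _ , q-prime , q≢2 , q∣m) | _ = odd-prime-step q-prime q≢2 q∣m ih
  ... | no none | yes 16∣m = sixteen-step 16∣m ih
  ... | no none | no 16∤m  = λ 1≤m → power-of-two-case 1≤m (only-prime-factor-2 1≤m none) 16∤m 1≤m

norm : ℕ → ℤ → ℤ → ℤ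
norm p t s = t * t + (+ p) * (+ p) * (s * s)

norm≡sum-of-squares : ∀ {n} p t s → + p * + p ≡ 1ℤ mod n → norm p t s ≡ t * t + s * s mod n
norm≡sum-of-squares p t s p²≡1 =
  +-cong-mod (mod-refl {x = t * t}) (mod-trans (*-cong-mod p²≡1 (mod-refl {x = s * s})) (≡⇒≡-mod (*-identityˡ (s * s))))

prime∤norm : ∀ {r} t s → Prime r → ¬ (+ r ∣ᵢ t) → ¬ (+ r ∣ᵢ norm r t s)
prime∤norm {r} t s r-prime r∤t r∣N with euclidsLemma ∣ t ∣ ∣ t ∣ r-prime (subst (r ∣_) (abs-* t t) (∣⇒∣ᵤ r∣t²))
  where
  r∣t² : + r ∣ᵢ t * t
  r∣t² = ∣ᵢ-≡ (split t s (+ r)) (∣m∣n⇒∣m-n r∣N (∣ᵢ.divides (+ r * (s * s)) (regroup (+ r) s)))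
    where
    split : ∀ t s r → t * t ≡ (t * t + r * r * (s * s)) - r * r * (s * s)
    split = solve-∀
    regroup : ∀ r s → r * r * (s * s) ≡ r * (s * s) * r
    regroup = solve-∀
... | inj₁ r∣t = r∤t (∣ᵤ⇒∣ r∣t)
... | inj₂ r∣t = r∤t (∣ᵤ⇒∣ r∣t)

square≡1-mod3 : ∀ {x} → ¬ (+ 3 ∣ᵢ x) → x * x ≡ 1ℤ mod 3
square≡1-mod3 {x} 3∤x = by-remainder (x %ℕ 3) (n%ℕd<d x 3) (≡-remainder x 3)
  where
  by-remainder : ∀ r → r < 3 → x ≡ + r mod 3 → x * x ≡ 1ℤ mod 3
  by-remainder 0 _ x≡0 = contradiction (∣-resp-mod x≡0 (∣ᵢ.divides 0ℤ refl)) 3∤x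
  by-remainder 1 _ x≡1 = *-cong-mod x≡1 x≡1
  by-remainder 2 _ x≡2 = mod-trans (*-cong-mod x≡2 x≡2) (mkMod (∣ᵢ.divides 1ℤ refl))
  by-remainder (suc (suc (suc _))) (s≤s (s≤s (s≤s ()))) _

-- Since squares are ≡ 0 or 1 modulo 3, 3 ∣ t² + s² forces 3 ∣ t and 3 ∣ s.
three∣sum-of-squares : ∀ {t s} → + 3 ∣ᵢ t * t + s * s → + 3 ∣ᵢ t × + 3 ∣ᵢ s
three∣sum-of-squares {t} {s} 3∣T =
  by-remainders (t %ℕ 3) (s %ℕ 3) (n%ℕd<d t 3) (n%ℕd<d s 3) (≡-remainder t 3) (≡-remainder s 3)
  where
  residues : ∀ {r₁ r₂} → t ≡ + r₁ mod 3 → s ≡ + r₂ mod 3 → + 3 ∣ᵢ + r₁ * + r₁ + + r₂ * + r₂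
  residues t≡r₁ s≡r₂ = ∣-resp-mod (mod-sym (sum-of-squares-cong t≡r₁ s≡r₂)) 3∣T
  impossible : ∀ {r₁ r₂} → t ≡ + r₁ mod 3 → s ≡ + r₂ mod 3 → ¬ (+ 3 ∣ᵢ + r₁ * + r₁ + + r₂ * + r₂) →
               + 3 ∣ᵢ t × + 3 ∣ᵢ s
  impossible t≡r₁ s≡r₂ 3∤ = contradiction (residues t≡r₁ s≡r₂) 3∤
  by-remainders : ∀ r₁ r₂ → r₁ < 3 → r₂ < 3 → t ≡ + r₁ mod 3 → s ≡ + r₂ mod 3 → + 3 ∣ᵢ t × + 3 ∣ᵢ s
  by-remainders 0 0 _ _ t≡0 s≡0 = ∣-resp-mod t≡0 (∣ᵢ.divides 0ℤ refl) , ∣-resp-mod s≡0 (∣ᵢ.divides 0ℤ refl)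
  by-remainders 0 1 _ _ t≡ s≡ = impossible t≡ s≡ (from-no (+ 3 ∣ᵢ? + 1))
  by-remainders 0 2 _ _ t≡ s≡ = impossible t≡ s≡ (from-no (+ 3 ∣ᵢ? + 4))
  by-remainders 1 0 _ _ t≡ s≡ = impossible t≡ s≡ (from-no (+ 3 ∣ᵢ? + 1))
  by-remainders 1 1 _ _ t≡ s≡ = impossible t≡ s≡ (from-no (+ 3 ∣ᵢ? + 2))
  by-remainders 1 2 _ _ t≡ s≡ = impossible t≡ s≡ (from-no (+ 3 ∣ᵢ? + 5))
  by-remainders 2 0 _ _ t≡ s≡ = impossible t≡ s≡ (from-no (+ 3 ∣ᵢ? + 4))
  by-remainders 2 1 _ _ t≡ s≡ = impossible t≡ s≡ (from-no (+ 3 ∣ᵢ? + 5))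
  by-remainders 2 2 _ _ t≡ s≡ = impossible t≡ s≡ (from-no (+ 3 ∣ᵢ? + 8))
  by-remainders (suc (suc (suc _))) _ (s≤s (s≤s (s≤s ()))) _ _ _
  by-remainders _ (suc (suc (suc _))) _ (s≤s (s≤s (s≤s ()))) _ _

coprime-* : ∀ {n x y} → Coprime n x → Coprime n y → Coprime n (x ℕ.* y)
coprime-* {n} {x} {y} n⊥x n⊥y (d∣n , d∣xy) = n⊥y (d∣n , coprime-divisor d⊥x d∣xy)
  where
  d⊥x : Coprime _ x
  d⊥x (e∣d , e∣x) = n⊥x (∣-trans e∣d d∣n , e∣x)

module Adjustment {p m : ℕ} (p-prime : Prime p) (2<p : 2 < p) (1≤m : 1 ≤ m) (m∣p-1 : m ∣ p ∸ 1) where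

  1<p : 1 < p
  1<p = ℕ.≤-trans (s≤s (s≤s z≤n)) (ℕ.<⇒≤ 2<p)

  K : ℤ
  K = + 6 * + m * + p

  ∣K∣ : ∣ K ∣ ≡ 6 ℕ.* m ℕ.* p
  ∣K∣ = trans (abs-* (+ 6 * + m) (+ p)) (cong (ℕ._* p) (abs-* (+ 6) (+ m)))

  p≡1-mod-m : + p ≡ 1ℤ mod m
  p≡1-mod-m = mkMod (subst (+ m ∣ᵢ_) (sym (trans (m-n≡m⊖n p 1) (⊖-≥ {p} {1} (ℕ.<⇒≤ 1<p))))
                           (∣ᵤ⇒∣ m∣p-1))

  norm≡-mod-m : ∀ t s → norm p t s ≡ t * t + s * s mod m
  norm≡-mod-m t s = norm≡sum-of-squares p t s (*-cong-mod p≡1-mod-m p≡1-mod-m)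

  norm≡-mod2 : ∀ t s → norm p t s ≡ t * t + s * s mod 2
  norm≡-mod2 t s = norm≡sum-of-squares p t s (*-cong-mod p≡1 p≡1)
    where
    p≡1 : + p ≡ 1ℤ mod 2
    p≡1 = odd⇒≡1 (λ 2∣p → ℕ.<-irrefl (prime∣prime⇒≡ prime[2] p-prime (∣⇒∣ᵤ 2∣p)) 2<p)

  -- p ∤ m, because 1 ≤ m ≤ p − 1.
  p∤m : ¬ (+ p ∣ᵢ + m)
  p∤m p∣m = ℕ.<⇒≱ m<p (∣⇒≤ {{ℕ.>-nonZero 1≤m}} (∣⇒∣ᵤ p∣m))
    where
    m<p : m < p
    m<p = ℕ.m≤pred[n]⇒suc[m]≤n {{ℕ.>-nonZero (ℕ.<-trans (s≤s z≤n) 1<p)}}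
            (∣⇒≤ {{ℕ.>-nonZero (ℕ.m<n⇒0<n∸m 1<p)}} m∣p-1)

  norm-gcd≡1 : ∀ {A t s} → Unit m A → A ≡ t * t + s * s mod m → ¬ (+ p ∣ᵢ t) → ¬ (+ 2 ∣ᵢ t + s) →
               ¬ (+ 3 ∣ᵢ t × + 3 ∣ᵢ s) → gcd (norm p t s) K ≡ + 1
  norm-gcd≡1 {A} {t} {s} unit A≡ p∤t odd ¬3∣both =
    cong +_ (coprime⇒gcd≡1 (subst (Coprime ∣ N ∣) (sym ∣K∣) (coprime-* (coprime-* (coprime-* N⊥2 N⊥3) N⊥m) N⊥p)))
    where
    N : ℤ
    N = norm p t s
    N⊥2 : Coprime ∣ N ∣ 2
    N⊥2 = prime∤⇒coprimeᵢ prime[2] (λ 2∣N →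
            odd (∣-resp-mod (mod-sym (mod-trans (norm≡-mod2 t s) (+-cong-mod (square≡self-mod2 t) (square≡self-mod2 s)))) 2∣N))
    p∤N : ¬ (+ p ∣ᵢ N)
    p∤N = prime∤norm t s p-prime p∤t
    N⊥3 : Coprime ∣ N ∣ 3
    N⊥3 with p ℕ.≟ 3
    ... | yes p≡3 = prime∤⇒coprimeᵢ prime[3] (subst (λ r → ¬ (+ r ∣ᵢ N)) p≡3 p∤N)
    ... | no p≢3  = prime∤⇒coprimeᵢ prime[3] (λ 3∣N → ¬3∣both (three∣sum-of-squares (∣-resp-mod (mod-sym N≡T) 3∣N)))
      where
      N≡T : N ≡ t * t + s * s mod 3
      N≡T = norm≡sum-of-squares p t s
              (square≡1-mod3 {+ p} (λ 3∣p → p≢3 (sym (prime∣prime⇒≡ prime[3] p-prime (∣⇒∣ᵤ 3∣p)))))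
    N⊥m : Coprime ∣ N ∣ m
    N⊥m = Coprimality.sym (unit⇒coprime {x = N} (unit-cong (mod-trans A≡ (mod-sym (norm≡-mod-m t s))) unit))
    N⊥p : Coprime ∣ N ∣ p
    N⊥p = prime∤⇒coprimeᵢ p-prime p∤N

  avoid-p : ∀ t₀ → ∃[ t ] (t ≡ t₀ mod m × ¬ (+ p ∣ᵢ t))
  avoid-p t₀ with + p ∣ᵢ? t₀
  ... | no p∤t₀  = t₀ , mod-refl , p∤t₀
  ... | yes p∣t₀ = t₀ + 1ℤ * + m , +-multiple-mod t₀ 1ℤ ,
                   λ p∣t → p∤m (subst (+ p ∣ᵢ_) (*-identityˡ (+ m)) (∣m+n∣m⇒∣n p∣t p∣t₀))

  -- Step 2: if t + s is even, then m is odd (else t + s ≡ A mod 2 and 2 ∣ A), so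
  -- replacing s by s + m makes t + s odd.
  make-odd : ∀ {A t} s₀ → Unit m A → A ≡ t * t + s₀ * s₀ mod m → ∃[ s ] (s ≡ s₀ mod m × ¬ (+ 2 ∣ᵢ t + s))
  make-odd {A} {t} s₀ unit A≡ with + 2 ∣ᵢ? t + s₀
  ... | no odd      = s₀ , mod-refl , odd
  ... | yes 2∣t+s₀ = s₀ + 1ℤ * + m , +-multiple-mod s₀ 1ℤ , λ 2∣ → m-odd (2∣m 2∣)
    where
    m-odd : ¬ (2 ∣ m)
    m-odd 2∣m = unit⇒prime∤ unit prime[2] 2∣m
                  (∣-resp-mod (mod-trans (mod-divisor 2∣m A≡) (+-cong-mod (square≡self-mod2 t) (square≡self-mod2 s₀))) 2∣t+s₀)
    2∣m : + 2 ∣ᵢ t + (s₀ + 1ℤ * + m) → 2 ∣ m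
    2∣m 2∣ = ∣⇒∣ᵤ (subst (+ 2 ∣ᵢ_) (*-identityˡ (+ m)) (∣m+n∣m⇒∣n (∣ᵢ-≡ (+-assoc t s₀ (1ℤ * + m)) 2∣) 2∣t+s₀))

  -- Step 3: if 3 ∣ t and 3 ∣ s, then 3 ∤ m (else 3 ∣ A), so replacing s by
  -- s + 2m keeps t + s odd and makes 3 ∤ s.
  avoid-3 : ∀ {A t} s₁ → Unit m A → A ≡ t * t + s₁ * s₁ mod m → ¬ (+ 2 ∣ᵢ t + s₁) →
            ∃[ s ] (s ≡ s₁ mod m × ¬ (+ 2 ∣ᵢ t + s) × ¬ (+ 3 ∣ᵢ t × + 3 ∣ᵢ s))
  avoid-3 {A} {t} s₁ unit A≡ odd with + 3 ∣ᵢ? t | + 3 ∣ᵢ? s₁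
  ... | no 3∤t | _         = s₁ , mod-refl , odd , λ (3∣t , _) → 3∤t 3∣t
  ... | yes _  | no 3∤s₁   = s₁ , mod-refl , odd , λ (_ , 3∣s) → 3∤s₁ 3∣s
  ... | yes 3∣t | yes 3∣s₁ = s₁ + + 2 * + m , +-multiple-mod s₁ (+ 2) , still-odd , λ (_ , 3∣s) → 3∤2m (∣m+n∣m⇒∣n 3∣s 3∣s₁)
    where
    2∣2m : + 2 ∣ᵢ + 2 * + m
    2∣2m = ∣ᵢ.divides (+ m) (*-comm (+ 2) (+ m))
    still-odd : ¬ (+ 2 ∣ᵢ t + (s₁ + + 2 * + m))
    still-odd 2∣ = odd (∣m+n∣n⇒∣m (∣ᵢ-≡ (+-assoc t s₁ (+ 2 * + m)) 2∣) 2∣2m)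
    3∤2m : ¬ (+ 3 ∣ᵢ + 2 * + m)
    3∤2m 3∣2m with euclidsLemma 2 m prime[3] (subst (3 ∣_) (abs-* (+ 2) (+ m)) (∣⇒∣ᵤ 3∣2m))
    ... | inj₁ 3∣2 = contradiction (prime∣prime⇒≡ prime[3] prime[2] 3∣2) λ ()
    ... | inj₂ 3∣m = unit⇒prime∤ unit prime[3] 3∣m
                       (∣-resp-mod (mod-divisor 3∣m A≡) (∣m∣n⇒∣m+n (∣m⇒∣m*n t 3∣t) (∣m⇒∣m*n s₁ 3∣s₁)))

  Good : ℤ → Set
  Good A = ∃[ t ] ∃[ s ] (gcd (norm p t s) K ≡ + 1 × (A ≡ t * t + s * s mod m))

  good-representation : ∀ {A} → Unit m A → TwoSquares m A → Good A
  good-representation {A} unit (t₀ , s₀ , A≡₀) = with-t (avoid-p t₀)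
    where
    with-t : ∃[ t ] (t ≡ t₀ mod m × ¬ (+ p ∣ᵢ t)) → Good A
    with-t (t , t≡t₀ , p∤t) = with-odd-s (make-odd {t = t} s₀ unit A≡₁)
      where
      A≡₁ : A ≡ t * t + s₀ * s₀ mod m
      A≡₁ = mod-trans A≡₀ (mod-sym (sum-of-squares-cong t≡t₀ (mod-refl {x = s₀})))
      with-odd-s : ∃[ s ] (s ≡ s₀ mod m × ¬ (+ 2 ∣ᵢ t + s)) → Good A
      with-odd-s (s₁ , s₁≡s₀ , odd) = finish (avoid-3 s₁ unit A≡₂ odd)
        where
        A≡₂ : A ≡ t * t + s₁ * s₁ mod m
        A≡₂ = mod-trans A≡₁ (mod-sym (sum-of-squares-cong (mod-refl {x = t}) s₁≡s₀))
        finish : ∃[ s ] (s ≡ s₁ mod m × ¬ (+ 2 ∣ᵢ t + s) × ¬ (+ 3 ∣ᵢ t × + 3 ∣ᵢ s)) → Good A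
        finish (s , s≡s₁ , odd′ , ¬3∣both) = t , s , norm-gcd≡1 unit A≡ p∤t odd′ ¬3∣both , A≡
          where
          A≡ : A ≡ t * t + s * s mod m
          A≡ = mod-trans A≡₂ (mod-sym (sum-of-squares-cong (mod-refl {x = t}) s≡s₁))

  unit⇒±good : ∀ {a} → Unit m a → Good a ⊎ Good (- a)
  unit⇒±good {a} unit = Sum.map (good-representation unit) (good-representation (unit-neg {a = a} unit))
                                (units-are-±twoSquares m 1≤m unit)

  -- Conversely, gcd(t² + p²s², 6mp) = 1 makes t² + s² ≡ t² + p²s² a unit modulo m.
  good⇒unit : ∀ t s → gcd (norm p t s) K ≡ + 1 → Unit m (t * t + s * s)
  good⇒unit t s gcd≡1 = unit-cong (norm≡-mod-m t s) (coprime⇒unit {x = norm p t s} m⊥N)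
    where
    m⊥N : Coprime m ∣ norm p t s ∣
    m⊥N (d∣m , d∣N) = gcd≡1⇒coprime (+-injective gcd≡1) (d∣N , subst (_ ∣_) (sym ∣K∣) (∣-trans d∣m (n∣m*n*o 6 p)))

unit⇒isUnitMod : ∀ {m a} → Unit m a → IsUnitMod m a
unit⇒isUnitMod (b , ab≡1) = b , ∣⇒∣ᵤ (n∣x-y ab≡1)

lemma2 : (p m : ℕ) → Prime p → 2 < p → 1 ≤ m → m ∣ (p ∸ 1) →
         (a : ℤ) → IsUnitMod m a ⇔ InSet p m a
lemma2 p m p-prime 2<p 1≤m m∣p-1 a = mk⇔ forward backward
  where
  open Adjustment p-prime 2<p 1≤m m∣p-1

  forward : IsUnitMod m a → InSet p m a
  forward (b , m∣ab-1) = [ from-good , from-good-neg ]′ (unit⇒±good (b , mkMod (∣ᵤ⇒∣ m∣ab-1)))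
    where
    from-good : Good a → InSet p m a
    from-good (t , s , gcd≡1 , a≡T) = t , s , gcd≡1 , inj₁ (∣⇒∣ᵤ (n∣x-y a≡T))
    from-good-neg : Good (- a) → InSet p m a
    from-good-neg (t , s , gcd≡1 , −a≡T) =
      t , s , gcd≡1 , inj₂ (∣⇒∣ᵤ (n∣x-y (mod-trans (≡⇒≡-mod (sym (neg-involutive a))) (-cong-mod −a≡T))))

  backward : InSet p m a → IsUnitMod m a
  backward (t , s , gcd≡1 , inj₁ m∣a-T) =
    unit⇒isUnitMod {m} {a} (unit-cong {a = t * t + s * s} {a} (mod-sym (mkMod (∣ᵤ⇒∣ m∣a-T))) (good⇒unit t s gcd≡1))
  backward (t , s , gcd≡1 , inj₂ m∣a+T) =
    unit⇒isUnitMod {m} {a} (unit-cong {a = - (t * t + s * s)} {a} (mod-sym (mkMod (∣ᵤ⇒∣ m∣a+T)))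
                                       (unit-neg {a = t * t + s * s} (good⇒unit t s gcd≡1)))
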